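{- Let $(x,y,z,m,n)$ be a nontrivial solution in positive integers with $x>y$ of $\phi\left(z\frac{x^m-y^m}{x-y}\right)=z\frac{x^n-y^n}{x-y}$ such that $1\le z\le x-y$ and $\gcd(m,n)=1$. Then $m$ is odd.
   Context: $\phi$ is Euler's totient function. A solution $(x,y,z,m,n)$ of this equation in positive integers with $x>y$ is trivial if it equals $(a,b,1,1,1)$ for integers $a>b\ge1$; otherwise nontrivial. -}

module Defs where

open import Data.Nat using (ℕ; zero; suc; _+_)
open import Data.Nat.GCD using (gcd)
open import Data.Nat using (_≟_)
open import Relation.Nullary.Decidable using (does)
open import Data.Bool using (if_then_else_)

φ : ℕ → ℕ
φ n = go n
  where
  go : ℕ → ℕ
  go zero    = 0
  go (suc k) = (if does (gcd (suc k) n ≟ 1) then 1 else 0) + go k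

open import Data.Nat.DivMod using () renaming (_/_ to _div_)

-- Natural-number division a / d (floor); the divisor 0 case is a dummy 0.
-- In the statement it is only applied to (x^k - y^k) / (x - y) with x > y,
-- where the division is exact.
_/_ : ℕ → ℕ → ℕ
a / zero  = 0
a / suc d = a div suc d

-- Suppose m were even, so that n is odd. With U k = (x^k − y^k)/(x − y) and N = z U m,
-- φ N < N forces n < m, hence x φ N = x z U n < z U (n + 1) ≤ N. For odd n the 2-adic
-- valuation of U n is at most that of U m (halve x and y while both are even; otherwise
-- U n is odd), so v₂(φ N) = v₂(z U n) ≤ v₂(N). But N/φ N > 3 forces v₂(φ N) > v₂(N):
-- write N = 2^s q with q odd; if s = 0 it suffices that φ q is even, and if s > 0 then
-- φ N = 2^(s−1) φ q, where 4 divides φ q unless q is 1 or a power of an odd prime p,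
-- cases in which N/φ N ≤ 2p/(p − 1) ≤ 3. This settles x ≥ 3. If x = 2 then y = z = 1,
-- and φ(2^m − 1) is even while 2^n − 1 is odd.

module Submission where

open import Defs
open import Data.Nat hiding (_/_)
open import Data.Nat.Properties
open import Algebra.Properties.CommutativeSemigroup *-commutativeSemigroup using (x∙yz≈y∙xz; interchange)
open import Algebra.Properties.Semiring.Sum +-*-semiring
  using (sum; sum-syntax; sum-cong-≗; sum-permute; sum-init-last; ∑-comm; *-distribˡ-sum; *-distribʳ-sum)
open import Data.Bool using (if_then_else_)
open import Data.Empty using (⊥)
open import Data.Fin as Fin using (Fin; toℕ; fromℕ<; combine; _↑ˡ_; _↑ʳ_)
open import Data.Fin.Permutation using (permutation)
open import Data.Fin.Properties
  using (toℕ-combine; toℕ-fromℕ<; toℕ-injective; toℕ<n; toℕ-inject₁; toℕ-fromℕ; any?; punchOut-injective; injective⇒≤)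
open import Data.List using ([]; _∷_)
open import Data.List.Relation.Unary.All using (_∷_)
open import Data.Nat.Coprimality as Coprime using (Coprime; coprime?; coprime⇒gcd≡1; gcd≡1⇒coprime)
open import Data.Nat.Divisibility
open import Data.Nat.DivMod using (_%_; m%n<n; m≡m%n+[m/n]*n; m*n/n≡m) renaming (_/_ to _div_)
open import Data.Nat.GCD using (gcd; gcd-greatest)
open import Data.Nat.Induction using (<-rec)
open import Data.Nat.ListAction using (product)
open import Data.Nat.Primality using (Prime; prime⇒nonTrivial; prime⇒irreducible; euclidsLemma; prime[2])
open import Data.Nat.Primality.Factorisation using (factorise)
open import Data.Nat.Tactic.RingSolver using (solve-∀)
open import Data.Product using (∃; ∃₂; _,_; proj₁; proj₂; _×_)
open import Data.Sum using (_⊎_; inj₁; inj₂)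
open import Function using (_∘_)
open import Function.Bundles using (_⇔_; mk⇔; Equivalence)
open import Function.Definitions using (Injective)
open import Relation.Binary.PropositionalEquality
open import Relation.Nullary using (yes; no; ¬_; contradiction)
open import Relation.Nullary.Decidable using (does)
open ≤-Reasoning

∑-++ : ∀ m {n} (f : Fin (m + n) → ℕ) → sum f ≡ sum (f ∘ (_↑ˡ n)) + sum (f ∘ (m ↑ʳ_))
∑-++ zero    f = refl
∑-++ (suc m) f = trans (cong (f Fin.zero +_) (∑-++ m (f ∘ Fin.suc))) (sym (+-assoc (f Fin.zero) _ _))

∑-combine : ∀ m n (f : Fin (m * n) → ℕ) → sum f ≡ ∑[ i < m ] ∑[ j < n ] f (combine i j)
∑-combine zero    n f = refl
∑-combine (suc m) n f = trans (∑-++ n f) (cong (sum (f ∘ (_↑ˡ (m * n))) +_) (∑-combine m n (f ∘ (n ↑ʳ_))))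

∑-const : ∀ n c → ∑[ i < n ] c ≡ n * c
∑-const zero    c = refl
∑-const (suc n) c = cong (c +_) (∑-const n c)

∑≤n : ∀ {n} (f : Fin n → ℕ) → (∀ i → f i ≤ 1) → sum f ≤ n
∑≤n {zero}  f f≤1 = z≤n
∑≤n {suc n} f f≤1 = +-mono-≤ (f≤1 Fin.zero) (∑≤n (f ∘ Fin.suc) (f≤1 ∘ Fin.suc))

injective⇒surjective : ∀ {n} (σ : Fin n → Fin n) → Injective _≡_ _≡_ σ → ∀ j → ∃ λ i → σ i ≡ j
injective⇒surjective {suc n} σ σ-inj j with any? (λ i → σ i Fin.≟ j)
... | yes hit = hit
... | no miss = contradiction (injective⇒≤ avoid-j-injective) (n≮n n)
  where
  avoid-j : Fin (suc n) → Fin n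
  avoid-j i = Fin.punchOut (λ eq → miss (i , sym eq))
  avoid-j-injective : Injective _≡_ _≡_ avoid-j
  avoid-j-injective {i} {i′} = σ-inj ∘ punchOut-injective (λ eq → miss (i , sym eq)) (λ eq → miss (i′ , sym eq))

∑-reindex : ∀ {n} (f : Fin n → ℕ) (σ : Fin n → Fin n) → Injective _≡_ _≡_ σ →
            ∑[ i < n ] f (σ i) ≡ sum f
∑-reindex f σ σ-inj = sym (sum-permute f π)
  where
  surj = injective⇒surjective σ σ-inj
  π = permutation σ (proj₁ ∘ surj) (proj₂ ∘ surj) (λ i → σ-inj (proj₂ (surj (σ i))))

sumBelow : ℕ → (ℕ → ℕ) → ℕ
sumBelow n f = ∑[ k < n ] f (toℕ k)

sumBelow-snoc : ∀ n f → sumBelow (suc n) f ≡ sumBelow n f + f n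
sumBelow-snoc n f = begin-equality
  sumBelow (suc n) f                                         ≡⟨ sum-init-last {n} (f ∘ toℕ) ⟩
  ∑[ i < n ] f (toℕ (Fin.inject₁ i)) + f (toℕ (Fin.fromℕ n))
    ≡⟨ cong₂ _+_ (sum-cong-≗ {n} (cong f ∘ toℕ-inject₁)) (cong f (toℕ-fromℕ n)) ⟩
  sumBelow n f + f n                                         ∎

sumBelow-* : ∀ m n f → sumBelow (m * n) f ≡ sumBelow m (λ i → sumBelow n (λ j → f (n * i + j)))
sumBelow-* m n f = trans (∑-combine m n (f ∘ toℕ))
  (sum-cong-≗ {m} λ i → sum-cong-≗ {n} λ j → cong f (toℕ-combine i j))

coprime-*⇒ˡ : ∀ {k a b} → Coprime k (a * b) → Coprime k a
coprime-*⇒ˡ {b = b} k⊥ab (d∣k , d∣a) = k⊥ab (d∣k , ∣m⇒∣m*n b d∣a)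

coprime-*⇒ʳ : ∀ {k a b} → Coprime k (a * b) → Coprime k b
coprime-*⇒ʳ {a = a} k⊥ab (d∣k , d∣b) = k⊥ab (d∣k , ∣n⇒∣m*n a d∣b)

coprime-*⇐ : ∀ {k a b} → Coprime k a → Coprime k b → Coprime k (a * b)
coprime-*⇐ {a = a} k⊥a k⊥b {d} (d∣k , d∣ab) = k⊥b (d∣k , Coprime.coprime-divisor d⊥a d∣ab)
  where
  d⊥a : Coprime d a
  d⊥a (e∣d , e∣a) = k⊥a (∣-trans e∣d d∣k , e∣a)

coprime-^ : ∀ {k p} e → Coprime k p → Coprime k (p ^ e)
coprime-^ zero    k⊥p (_ , d∣1) = ∣1⇒≡1 d∣1
coprime-^ (suc e) k⊥p = coprime-*⇐ k⊥p (coprime-^ e k⊥p)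

prime∤⇒coprime : ∀ {p r} → Prime p → ¬ p ∣ r → Coprime p r
prime∤⇒coprime p-prime p∤r (d∣p , d∣r) with prime⇒irreducible p-prime d∣p
... | inj₁ d≡1 = d≡1
... | inj₂ refl = contradiction d∣r p∤r

-- The totient as a sum of coprimality indicators
δ₁ : ℕ → ℕ
δ₁ g = if does (g ≟ 1) then 1 else 0

δ₁-≢1 : ∀ {g} → g ≢ 1 → δ₁ g ≡ 0
δ₁-≢1 {zero}        _   = refl
δ₁-≢1 {suc zero}    g≢1 = contradiction refl g≢1
δ₁-≢1 {suc (suc _)} _   = refl

χ : ℕ → ℕ → ℕ
χ n k = δ₁ (gcd k n)

χ-coprime : ∀ {n k} → Coprime k n → χ n k ≡ 1
χ-coprime c rewrite coprime⇒gcd≡1 c = refl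

χ-¬coprime : ∀ {n k} → ¬ Coprime k n → χ n k ≡ 0
χ-¬coprime ¬c = δ₁-≢1 (¬c ∘ gcd≡1⇒coprime)

χ-cong : ∀ {n k m j} → Coprime k n ⇔ Coprime j m → χ n k ≡ χ m j
χ-cong {n} {k} {m} {j} k⊥n⇔j⊥m with coprime? k n
... | yes k⊥n = trans (χ-coprime k⊥n) (sym (χ-coprime (Equivalence.to k⊥n⇔j⊥m k⊥n)))
... | no ¬k⊥n = trans (χ-¬coprime ¬k⊥n) (sym (χ-¬coprime (¬k⊥n ∘ Equivalence.from k⊥n⇔j⊥m)))

χ≤1 : ∀ n k → χ n k ≤ 1
χ≤1 n k with coprime? k n
... | yes k⊥n = ≤-reflexive (χ-coprime k⊥n)
... | no ¬k⊥n = ≤-trans (≤-reflexive (χ-¬coprime ¬k⊥n)) z≤n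

χ-0 : ∀ n .{{_ : NonTrivial n}} → χ n 0 ≡ 0
χ-0 n = χ-¬coprime Coprime.¬0-coprimeTo-2+

χ-* : ∀ a b k → χ (a * b) k ≡ χ a k * χ b k
χ-* a b k with coprime? k a | coprime? k b
... | yes k⊥a | yes k⊥b = trans (χ-coprime (coprime-*⇐ k⊥a k⊥b))
                                (sym (cong₂ _*_ (χ-coprime k⊥a) (χ-coprime k⊥b)))
... | no ¬k⊥a | _       = trans (χ-¬coprime (¬k⊥a ∘ coprime-*⇒ˡ {k} {a} {b}))
                                (sym (cong (_* χ b k) (χ-¬coprime ¬k⊥a)))
... | yes k⊥a | no ¬k⊥b = trans (χ-¬coprime (¬k⊥b ∘ coprime-*⇒ʳ {k} {a} {b}))
                                (sym (cong₂ _*_ (χ-coprime k⊥a) (χ-¬coprime ¬k⊥b)))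

χ-^ : ∀ p e k → χ (p ^ suc e) k ≡ χ p k
χ-^ p e k = χ-cong {p ^ suc e} {k} {p} {k} (mk⇔ coprime-*⇒ˡ (coprime-^ (suc e)))

χ-periodic : ∀ n j i → χ n (n * j + i) ≡ χ n i
χ-periodic n j i = χ-cong {n} {n * j + i} {n} {i} (mk⇔
  (λ c {_} (d∣i , d∣n) → c (∣m∣n⇒∣m+n (∣m⇒∣m*n j d∣n) d∣i , d∣n))
  (λ c {_} (d∣s , d∣n) → c (∣m+n∣m⇒∣n d∣s (∣m⇒∣m*n j d∣n) , d∣n)))

χ-% : ∀ n k .{{_ : NonZero n}} → χ n (k % n) ≡ χ n k
χ-% n k = χ-cong {n} {k % n} {n} {k} (mk⇔
  (λ c {_} (d∣k , d∣n) → c (%-presˡ-∣ d∣k d∣n , d∣n))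
  (λ c {_} (d∣k%n , d∣n) → c (∣n∣m%n⇒∣m d∣n d∣k%n , d∣n)))

-- Defs computes φ through a local helper that cannot be named here; the metavariable
-- φ-loop is solved by unification against it (abstracting gcd first keeps the
-- abstraction of suc K well-typed). Defs counts k = 1, …, n, whereas sumBelow runs over
-- the residues 0, …, n − 1; the two agree because χ n n ≡ χ n 0.
mutual
  φ-loop : ℕ → ℕ → ℕ
  φ-loop = _

  φ-unfold : ∀ K → φ (suc K) ≡ χ (suc K) (suc K) + φ-loop (suc K) K
  φ-unfold K with gcd (suc K) (suc K)
  ... | _ with suc K
  ... | _ = refl

φ-loop≡sumBelow : ∀ n k → φ-loop n k ≡ sumBelow k (χ n ∘ suc)
φ-loop≡sumBelow n zero    = refl
φ-loop≡sumBelow n (suc k) = begin-equality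
  χ n (suc k) + φ-loop n k               ≡⟨ +-comm (χ n (suc k)) _ ⟩
  φ-loop n k + χ n (suc k)               ≡⟨ cong (_+ χ n (suc k)) (φ-loop≡sumBelow n k) ⟩
  sumBelow k (χ n ∘ suc) + χ n (suc k)   ≡⟨ sumBelow-snoc k (χ n ∘ suc) ⟨
  sumBelow (suc k) (χ n ∘ suc)           ∎

φ≡sumBelow : ∀ n → φ n ≡ sumBelow n (χ n)
φ≡sumBelow zero    = refl
φ≡sumBelow (suc K) = begin-equality
  φ N                                 ≡⟨ φ-unfold K ⟩
  χ N N + φ-loop N K                  ≡⟨ cong₂ _+_ χNN≡χN0 (φ-loop≡sumBelow N K) ⟩
  χ N 0 + sumBelow K (χ N ∘ suc)      ∎
  where
  N = suc K
  χNN≡χN0 : χ N N ≡ χ N 0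
  χNN≡χN0 = χ-cong {N} {N} {N} {0} (mk⇔
    (λ c {_} (_ , d∣N) → c (d∣N , d∣N))
    (λ c {_} (d∣N , _) → c (_ ∣0 , d∣N)))

sumBelow-periodic : ∀ t d → sumBelow (t * d) (χ d) ≡ t * φ d
sumBelow-periodic t d = begin-equality
  sumBelow (t * d) (χ d)                                ≡⟨ sumBelow-* t d (χ d) ⟩
  sumBelow t (λ i → sumBelow d (λ j → χ d (d * i + j)))
    ≡⟨ sum-cong-≗ {t} (λ i → sum-cong-≗ {d} (λ j → χ-periodic d (toℕ i) (toℕ j))) ⟩
  sumBelow t (λ _ → sumBelow d (χ d))                   ≡⟨ ∑-const t _ ⟩
  t * sumBelow d (χ d)                                  ≡⟨ cong (t *_) (φ≡sumBelow d) ⟨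
  t * φ d                                               ∎

φ-^ : ∀ p e → φ (p ^ suc e) ≡ p ^ e * φ p
φ-^ p e = begin-equality
  φ (p ^ suc e)                        ≡⟨ φ≡sumBelow (p ^ suc e) ⟩
  sumBelow (p * p ^ e) (χ (p ^ suc e)) ≡⟨ sum-cong-≗ {p * p ^ e} (χ-^ p e ∘ toℕ) ⟩
  sumBelow (p * p ^ e) (χ p)           ≡⟨ cong (λ n → sumBelow n (χ p)) (*-comm p (p ^ e)) ⟩
  sumBelow (p ^ e * p) (χ p)           ≡⟨ sumBelow-periodic (p ^ e) p ⟩
  p ^ e * φ p                          ∎

φ-prime : ∀ {p} → Prime p → φ p ≡ p ∸ 1
φ-prime {suc k} p-prime = begin-equality
  φ (suc k)                            ≡⟨ φ≡sumBelow (suc k) ⟩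
  χ (suc k) 0 + sumBelow k (χ (suc k) ∘ suc)
    ≡⟨ cong₂ _+_ (χ-0 (suc k) {{prime⇒nonTrivial p-prime}}) (sum-cong-≗ {k} χ-suc≡1) ⟩
  ∑[ i < k ] 1                         ≡⟨ ∑-const k 1 ⟩
  k * 1                                ≡⟨ *-identityʳ k ⟩
  k                                    ∎
  where
  χ-suc≡1 : ∀ i → χ (suc k) (suc (toℕ i)) ≡ 1
  χ-suc≡1 i = χ-coprime (Coprime.sym (Coprime.prime⇒coprime p-prime (s≤s (toℕ<n i))))

φ<n : ∀ n .{{_ : NonTrivial n}} → φ n < n
φ<n (suc k) = s≤s (≤-trans (≤-reflexive φ≡∑) (∑≤n {k} _ (λ i → χ≤1 (suc k) (suc (toℕ i)))))
  where
  φ≡∑ : φ (suc k) ≡ sumBelow k (χ (suc k) ∘ suc)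
  φ≡∑ = trans (φ≡sumBelow (suc k)) (cong (_+ sumBelow k (χ (suc k) ∘ suc)) (χ-0 (suc k)))

[m+o]%n≡m%n⇒n∣o : ∀ m o n .{{_ : NonZero n}} → (m + o) % n ≡ m % n → n ∣ o
[m+o]%n≡m%n⇒n∣o m o n eq = ∣m+n∣m⇒∣n (divides ((m + o) div n) q₀n+o≡q₁n) (n∣m*n (m div n))
  where
  q₀n+o≡q₁n : m div n * n + o ≡ (m + o) div n * n
  q₀n+o≡q₁n = +-cancelˡ-≡ (m % n) _ _ (begin-equality
    m % n + (m div n * n + o)       ≡⟨ +-assoc (m % n) _ o ⟨
    m % n + m div n * n + o         ≡⟨ cong (_+ o) (m≡m%n+[m/n]*n m n) ⟨
    m + o                           ≡⟨ m≡m%n+[m/n]*n (m + o) n ⟩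
    (m + o) % n + (m + o) div n * n ≡⟨ cong (_+ (m + o) div n * n) eq ⟩
    m % n + (m + o) div n * n       ∎)

∣∧<⇒≡0 : ∀ {n d} → n ∣ d → d < n → d ≡ 0
∣∧<⇒≡0 {d = zero}  _   _   = refl
∣∧<⇒≡0 {d = suc _} n∣d d<n = contradiction (∣⇒≤ n∣d) (<⇒≱ d<n)

affine-%-injective : ∀ {a b} .{{_ : NonZero a}} → Coprime a b → ∀ j {i i′} → i ≤ i′ → i′ < a →
                     (b * i′ + j) % a ≡ (b * i + j) % a → i′ ≡ i
affine-%-injective {a} {b} a⊥b j {i} {i′} i≤i′ i′<a eq = begin-equality
  i′           ≡⟨ m+[n∸m]≡n i≤i′ ⟨
  i + d        ≡⟨ cong (i +_) d≡0 ⟩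
  i + 0        ≡⟨ +-identityʳ i ⟩
  i            ∎
  where
  d = i′ ∸ i
  shift : b * i′ + j ≡ (b * i + j) + b * d
  shift = trans (cong (λ k → b * k + j) (sym (m+[n∸m]≡n i≤i′))) (regroup b i d j)
    where
    regroup : ∀ b i d j → b * (i + d) + j ≡ (b * i + j) + b * d
    regroup = solve-∀
  a∣bd : a ∣ b * d
  a∣bd = [m+o]%n≡m%n⇒n∣o (b * i + j) (b * d) a (trans (cong (_% a) (sym shift)) eq)
  d≡0 : d ≡ 0
  d≡0 = ∣∧<⇒≡0 (Coprime.coprime-divisor a⊥b a∣bd) (≤-<-trans (m∸n≤m i′ i) i′<a)

∑χ-affine : ∀ a b j → Coprime a b → ∑[ i < a ] χ a (b * toℕ i + j) ≡ φ a
∑χ-affine zero      b j _   = refl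
∑χ-affine a@(suc _) b j a⊥b = begin-equality
  ∑[ i < a ] χ a (b * toℕ i + j) ≡⟨ sum-cong-≗ {a} (λ i → trans (cong (χ a) (toℕσ i)) (χ-% a (b * toℕ i + j))) ⟨
  ∑[ i < a ] χ a (toℕ (σ i))     ≡⟨ ∑-reindex (χ a ∘ toℕ) σ σ-injective ⟩
  sumBelow a (χ a)               ≡⟨ φ≡sumBelow a ⟨
  φ a                            ∎
  where
  σ : Fin a → Fin a
  σ i = fromℕ< (m%n<n (b * toℕ i + j) a)
  toℕσ : ∀ i → toℕ (σ i) ≡ (b * toℕ i + j) % a
  toℕσ i = toℕ-fromℕ< (m%n<n (b * toℕ i + j) a)
  injective-on-ℕ : ∀ {i i′ : Fin a} → toℕ i ≤ toℕ i′ → σ i′ ≡ σ i → i′ ≡ i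
  injective-on-ℕ {i} {i′} i≤i′ eq = toℕ-injective (affine-%-injective a⊥b j i≤i′ (toℕ<n i′)
    (trans (sym (toℕσ i′)) (trans (cong toℕ eq) (toℕσ i))))
  σ-injective : Injective _≡_ _≡_ σ
  σ-injective {i} {i′} eq with ≤-total (toℕ i) (toℕ i′)
  ... | inj₁ i≤i′ = sym (injective-on-ℕ i≤i′ (sym eq))
  ... | inj₂ i′≤i = injective-on-ℕ i′≤i eq

φ-* : ∀ {a b} → Coprime a b → φ (a * b) ≡ φ a * φ b
φ-* {a} {b} a⊥b = begin-equality
  φ (a * b)                                           ≡⟨ φ≡sumBelow (a * b) ⟩
  sumBelow (a * b) (χ (a * b))                        ≡⟨ sumBelow-* a b (χ (a * b)) ⟩
  ∑[ i < a ] ∑[ j < b ] χ (a * b) (b * toℕ i + toℕ j) ≡⟨ sum-cong-≗ {a} (λ i → sum-cong-≗ {b} (χ-split i)) ⟩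
  ∑[ i < a ] ∑[ j < b ] (f i j * g j)                 ≡⟨ ∑-comm {a} {b} (λ i j → f i j * g j) ⟩
  ∑[ j < b ] ∑[ i < a ] (f i j * g j)                 ≡⟨ sum-cong-≗ {b} (λ j → *-distribʳ-sum {a} (g j) (λ i → f i j)) ⟨
  ∑[ j < b ] (∑[ i < a ] f i j * g j)                 ≡⟨ sum-cong-≗ {b} (λ j → cong (_* g j) (∑χ-affine a b (toℕ j) a⊥b)) ⟩
  ∑[ j < b ] (φ a * g j)                              ≡⟨ *-distribˡ-sum {b} (φ a) g ⟨
  φ a * sumBelow b (χ b)                              ≡⟨ cong (φ a *_) (φ≡sumBelow b) ⟨
  φ a * φ b                                           ∎
  where
  f : Fin a → Fin b → ℕ
  f i j = χ a (b * toℕ i + toℕ j)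
  g : Fin b → ℕ
  g j = χ b (toℕ j)
  χ-split : ∀ i j → χ (a * b) (b * toℕ i + toℕ j) ≡ f i j * g j
  χ-split i j = trans (χ-* a b (b * toℕ i + toℕ j)) (cong (f i j *_) (χ-periodic b (toℕ i) (toℕ j)))

φ-prime-power-* : ∀ {p r} e → Prime p → ¬ p ∣ r → φ (p ^ suc e * r) ≡ p ^ e * (p ∸ 1) * φ r
φ-prime-power-* {p} {r} e p-prime p∤r = begin-equality
  φ (p ^ suc e * r)     ≡⟨ φ-* (Coprime.sym (coprime-^ (suc e) r⊥p)) ⟩
  φ (p ^ suc e) * φ r   ≡⟨ cong (_* φ r) (trans (φ-^ p e) (cong (p ^ e *_) (φ-prime p-prime))) ⟩
  p ^ e * (p ∸ 1) * φ r ∎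
  where
  r⊥p : Coprime r p
  r⊥p = Coprime.sym (prime∤⇒coprime p-prime p∤r)

Odd : ℕ → Set
Odd n = ¬ 2 ∣ n

odd-1 : Odd 1
odd-1 2∣1 = contradiction (∣1⇒≡1 2∣1) λ ()

odd-* : ∀ {a b} → Odd a → Odd b → Odd (a * b)
odd-* {a} {b} odd-a odd-b 2∣ab with euclidsLemma a b prime[2] 2∣ab
... | inj₁ 2∣a = odd-a 2∣a
... | inj₂ 2∣b = odd-b 2∣b

odd-^ : ∀ {a} k → Odd a → Odd (a ^ k)
odd-^ zero    _     = odd-1
odd-^ (suc k) odd-a = odd-* odd-a (odd-^ k odd-a)

even⊎odd-suc : ∀ n → 2 ∣ n ⊎ 2 ∣ suc n
even⊎odd-suc zero    = inj₁ (2 ∣0)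
even⊎odd-suc (suc n) with even⊎odd-suc n
... | inj₁ 2∣n  = inj₂ (∣m∣n⇒∣m+n (∣-refl {2}) 2∣n)
... | inj₂ 2∣1+n = inj₁ 2∣1+n

odd⇒2∣pred : ∀ {n} → Odd n → 2 ∣ n ∸ 1
odd⇒2∣pred {zero}  odd = contradiction (2 ∣0) odd
odd⇒2∣pred {suc n} odd with even⊎odd-suc n
... | inj₁ 2∣n   = 2∣n
... | inj₂ 2∣1+n = contradiction 2∣1+n odd

even+odd : ∀ {a b} → 2 ∣ a → Odd b → Odd (a + b)
even+odd 2∣a odd-b 2∣a+b = odd-b (∣m+n∣m⇒∣n 2∣a+b 2∣a)

odd+even : ∀ {a b} → Odd a → 2 ∣ b → Odd (a + b)
odd+even {a} {b} odd-a 2∣b = subst Odd (+-comm b a) (even+odd 2∣b odd-a)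

odd+odd : ∀ {a b} → Odd a → Odd b → 2 ∣ a + b
odd+odd {zero}  {_}     odd-a _     = contradiction (2 ∣0) odd-a
odd+odd {suc a} {zero}  _     odd-b = contradiction (2 ∣0) odd-b
odd+odd {suc a} {suc b} odd-a odd-b = subst (2 ∣_) (cong suc (sym (+-suc a b)))
  (∣m∣n⇒∣m+n (∣-refl {2}) (∣m∣n⇒∣m+n (odd⇒2∣pred odd-a) (odd⇒2∣pred odd-b)))

odd⇒%2≡1 : ∀ {m} → Odd m → m % 2 ≡ 1
odd⇒%2≡1 {zero}        odd = contradiction (2 ∣0) odd
odd⇒%2≡1 {suc zero}    _   = refl
odd⇒%2≡1 {suc (suc m)} odd = odd⇒%2≡1 {m} (odd ∘ ∣m∣n⇒∣m+n ∣-refl)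

factor-out : ∀ p .{{_ : NonTrivial p}} n → 0 < n → ∃₂ λ e r → n ≡ p ^ e * r × ¬ p ∣ r
factor-out p = <-rec _ step
  where
  step : ∀ n → (∀ {m} → m < n → 0 < m → ∃₂ λ e r → m ≡ p ^ e * r × ¬ p ∣ r) →
         0 < n → ∃₂ λ e r → n ≡ p ^ e * r × ¬ p ∣ r
  step n rec 0<n with p ∣? n
  ... | no p∤n = 0 , n , sym (*-identityˡ n) , p∤n
  ... | yes p∣n = extend (rec (quotient-< p∣n) (>-nonZero⁻¹ q {{quotient≢0 p∣n}}))
    where
    instance
      n≢0 : NonZero n
      n≢0 = >-nonZero 0<n
    q = quotient p∣n
    extend : (∃₂ λ e r → q ≡ p ^ e * r × ¬ p ∣ r) → ∃₂ λ e r → n ≡ p ^ e * r × ¬ p ∣ r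
    extend (e , r , q≡pᵉr , p∤r) = suc e , r , n≡p¹⁺ᵉr , p∤r
      where
      n≡p¹⁺ᵉr : n ≡ p ^ suc e * r
      n≡p¹⁺ᵉr = begin-equality
        n               ≡⟨ m∣n⇒n≡m*quotient p∣n ⟩
        p * q           ≡⟨ cong (p *_) q≡pᵉr ⟩
        p * (p ^ e * r) ≡⟨ *-assoc p (p ^ e) r ⟨
        p ^ suc e * r   ∎

prime-power-split : ∀ {p} q → Prime p → p ∣ q → 0 < q → ∃₂ λ e r → q ≡ p ^ suc e * r × ¬ p ∣ r
prime-power-split {p} q p-prime p∣q 0<q with factor-out p {{prime⇒nonTrivial p-prime}} q 0<q
... | zero  , r , q≡1*r , p∤r = contradiction (subst (p ∣_) (trans q≡1*r (*-identityˡ r)) p∣q) p∤r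
... | suc e , r , q≡pᵉ⁺¹r , p∤r = e , r , q≡pᵉ⁺¹r , p∤r

prime-factor : ∀ n .{{_ : NonTrivial n}} → ∃ λ p → Prime p × p ∣ n
prime-factor n with factorise n {{nonTrivial⇒nonZero n}}
... | record { factors = [] ; isFactorisation = n≡1 } = contradiction n≡1 (>⇒≢ (nonTrivial⇒n>1 n))
... | record { factors = p ∷ ps ; isFactorisation = n≡p*Πps ; factorsPrime = p-prime ∷ _ } =
  p , p-prime , divides (product ps) (trans n≡p*Πps (*-comm p (product ps)))

^-monoʳ-∣ : ∀ a {m n} → m ≤ n → a ^ m ∣ a ^ n
^-monoʳ-∣ a {m} {n} m≤n = divides (a ^ (n ∸ m)) (begin-equality
  a ^ n               ≡⟨ cong (a ^_) (m+[n∸m]≡n m≤n) ⟨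
  a ^ (m + (n ∸ m))   ≡⟨ ^-distribˡ-+-* a m (n ∸ m) ⟩
  a ^ m * a ^ (n ∸ m) ≡⟨ *-comm (a ^ m) _ ⟩
  a ^ (n ∸ m) * a ^ m ∎)

2^k∣2^s*odd⇒k≤s : ∀ k s {q} → Odd q → 2 ^ k ∣ 2 ^ s * q → k ≤ s
2^k∣2^s*odd⇒k≤s k s {q} odd-q 2ᵏ∣2ˢq with k ≤? s
... | yes k≤s = k≤s
... | no  k≰s = contradiction (*-cancelˡ-∣ (2 ^ s) {{m^n≢0 2 s}} 2ˢ2∣2ˢq) odd-q
  where
  2ˢ2∣2ˢq : 2 ^ s * 2 ∣ 2 ^ s * q
  2ˢ2∣2ˢq = subst (_∣ 2 ^ s * q) (*-comm 2 (2 ^ s)) (∣-trans (^-monoʳ-∣ 2 (≰⇒> k≰s)) 2ᵏ∣2ˢq)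

-- The 2-adic valuation of the totient
[p∸1]∣φ : ∀ {p} q → Prime p → p ∣ q → 0 < q → p ∸ 1 ∣ φ q
[p∸1]∣φ {p} q p-prime p∣q 0<q with e , r , q≡pᵉ⁺¹r , p∤r ← prime-power-split q p-prime p∣q 0<q =
  subst (p ∸ 1 ∣_) (sym (trans (cong φ q≡pᵉ⁺¹r) (φ-prime-power-* e p-prime p∤r)))
    (∣m⇒∣m*n (φ r) (∣n⇒∣m*n (p ^ e) ∣-refl))

2∣φ-odd : ∀ q → 1 < q → Odd q → 2 ∣ φ q
2∣φ-odd q 1<q odd-q with p , p-prime , p∣q ← prime-factor q {{n>1⇒nonTrivial 1<q}} =
  ∣-trans (odd⇒2∣pred (λ 2∣p → odd-q (∣-trans 2∣p p∣q))) ([p∸1]∣φ q p-prime p∣q (<-trans z<s 1<q))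

odd-prime⇒3≤ : ∀ {p} → Prime p → Odd p → 3 ≤ p
odd-prime⇒3≤ {p} p-prime odd-p with m≤n⇒m<n∨m≡n (nonTrivial⇒n>1 p {{prime⇒nonTrivial p-prime}})
... | inj₁ 2<p  = 2<p
... | inj₂ refl = contradiction ∣-refl odd-p

2*p^[1+e]≤3*p^e*[p∸1] : ∀ {p} e → 3 ≤ p → 2 * p ^ suc e ≤ 3 * (p ^ e * (p ∸ 1))
2*p^[1+e]≤3*p^e*[p∸1] {suc (suc (suc k))} e (s≤s (s≤s (s≤s _))) = begin
  2 * ((3 + k) * P)    ≡⟨ lhs k P ⟩
  (6 + 2 * k) * P      ≤⟨ *-monoˡ-≤ P (+-monoʳ-≤ 6 (*-monoˡ-≤ k (n≤1+n 2))) ⟩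
  (6 + 3 * k) * P      ≡⟨ rhs k P ⟩
  3 * (P * (2 + k))    ∎
  where
  P = (3 + k) ^ e
  lhs : ∀ k P → 2 * ((3 + k) * P) ≡ (6 + 2 * k) * P
  lhs = solve-∀
  rhs : ∀ k P → (6 + 3 * k) * P ≡ 3 * (P * (2 + k))
  rhs = solve-∀

4∣φ⊎2q≤3φ-odd : ∀ q → 1 < q → Odd q → 4 ∣ φ q ⊎ 2 * q ≤ 3 * φ q
-- With q = p^(e+1) r: for r > 1 both p − 1 and φ r are even; for r = 1, q/φ q = p/(p − 1).
4∣φ⊎2q≤3φ-odd q 1<q odd-q with p , p-prime , p∣q ← prime-factor q {{n>1⇒nonTrivial 1<q}}
  with e , r , q≡pᵉ⁺¹r , p∤r ← prime-power-split q p-prime p∣q (<-trans z<s 1<q) = by-cases r q≡pᵉ⁺¹r p∤r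
  where
  odd-p : Odd p
  odd-p 2∣p = odd-q (∣-trans 2∣p p∣q)
  P = p ^ e * (p ∸ 1)
  by-cases : ∀ r → q ≡ p ^ suc e * r → ¬ p ∣ r → 4 ∣ φ q ⊎ 2 * q ≤ 3 * φ q
  by-cases zero _ p∤0 = contradiction (p ∣0) p∤0
  by-cases (suc zero) q≡pᵉ⁺¹ p∤1 = inj₂ (begin
    2 * q             ≡⟨ cong (2 *_) (trans q≡pᵉ⁺¹ (*-identityʳ (p ^ suc e))) ⟩
    2 * p ^ suc e     ≤⟨ 2*p^[1+e]≤3*p^e*[p∸1] e (odd-prime⇒3≤ p-prime odd-p) ⟩
    3 * P             ≡⟨ cong (3 *_) (*-identityʳ P) ⟨
    3 * (P * φ 1)     ≡⟨ cong (3 *_) (φ-prime-power-* e p-prime p∤1) ⟨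
    3 * φ (p ^ suc e * 1) ≡⟨ cong (λ n → 3 * φ n) q≡pᵉ⁺¹ ⟨
    3 * φ q           ∎)
  by-cases r@(suc (suc _)) q≡pᵉ⁺¹r p∤r = inj₁ (subst (4 ∣_) (sym (trans (cong φ q≡pᵉ⁺¹r) (φ-prime-power-* e p-prime p∤r)))
    (*-pres-∣ (∣n⇒∣m*n (p ^ e) (odd⇒2∣pred odd-p)) (2∣φ-odd r (s≤s (s≤s z≤n)) odd-r)))
    where
    odd-r : Odd r
    odd-r 2∣r = odd-q (∣-trans 2∣r (divides (p ^ suc e) q≡pᵉ⁺¹r))

φ[2^[1+s]*odd] : ∀ s {q} → Odd q → φ (2 ^ suc s * q) ≡ 2 ^ s * φ q
φ[2^[1+s]*odd] s {q} odd-q = trans (φ-prime-power-* s prime[2] odd-q) (cong (_* φ q) (*-identityʳ (2 ^ s)))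

2^[1+s]∣φ[2^s*q] : ∀ s {q} → Odd q → 3 * φ (2 ^ s * q) < 2 ^ s * q → 2 ^ suc s ∣ φ (2 ^ s * q)
2^[1+s]∣φ[2^s*q] zero {zero}          odd-q _ = contradiction (2 ∣0) odd-q
2^[1+s]∣φ[2^s*q] zero {suc zero} _ 3<1 = contradiction 3<1 λ { (s≤s ()) }
2^[1+s]∣φ[2^s*q] zero {q@(suc (suc _))} odd-q _ =
  subst (λ n → 2 ∣ φ n) (sym (*-identityˡ q)) (∣-trans (∣-reflexive (*-identityʳ 2)) (2∣φ-odd q (s≤s (s≤s z≤n)) odd-q))
2^[1+s]∣φ[2^s*q] (suc s) {zero} odd-q _ = contradiction (2 ∣0) odd-q
2^[1+s]∣φ[2^s*q] (suc s) {suc zero} _ 3φ<N = contradiction 3φ<N (≤⇒≯ (begin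
  2 ^ suc s * 1          ≡⟨ *-identityʳ (2 ^ suc s) ⟩
  2 * 2 ^ s              ≤⟨ *-monoˡ-≤ (2 ^ s) (n≤1+n 2) ⟩
  3 * 2 ^ s              ≡⟨ cong (3 *_) (*-identityʳ (2 ^ s)) ⟨
  3 * (2 ^ s * φ 1)      ≡⟨ cong (3 *_) (φ[2^[1+s]*odd] s odd-1) ⟨
  3 * φ (2 ^ suc s * 1)  ∎))
2^[1+s]∣φ[2^s*q] (suc s) {q@(suc (suc _))} odd-q 3φ<N with 4∣φ⊎2q≤3φ-odd q (s≤s (s≤s z≤n)) odd-q
... | inj₁ 4∣φq = subst₂ _∣_ (x*4≡2*[2*x] (2 ^ s)) (sym (φ[2^[1+s]*odd] s odd-q)) (*-monoʳ-∣ (2 ^ s) 4∣φq)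
  where
  x*4≡2*[2*x] : ∀ x → x * 4 ≡ 2 * (2 * x)
  x*4≡2*[2*x] = solve-∀
... | inj₂ 2q≤3φq = contradiction 3φ<N (≤⇒≯ (begin
  2 ^ suc s * q          ≡⟨ *-assoc 2 (2 ^ s) q ⟩
  2 * (2 ^ s * q)        ≡⟨ x∙yz≈y∙xz 2 (2 ^ s) q ⟩
  2 ^ s * (2 * q)        ≤⟨ *-monoʳ-≤ (2 ^ s) 2q≤3φq ⟩
  2 ^ s * (3 * φ q)      ≡⟨ x∙yz≈y∙xz (2 ^ s) 3 (φ q) ⟩
  3 * (2 ^ s * φ q)      ≡⟨ cong (3 *_) (φ[2^[1+s]*odd] s odd-q) ⟨
  3 * φ (2 ^ suc s * q)  ∎))

2^[1+k]∣φ : ∀ k {N} → 2 ^ k ∣ N → 3 * φ N < N → 2 ^ suc k ∣ φ N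
2^[1+k]∣φ k {N} 2ᵏ∣N 3φ<N with s , q , N≡2ˢq , odd-q ← factor-out 2 N (≤-<-trans z≤n 3φ<N) =
  ∣-trans (^-monoʳ-∣ 2 (s≤s k≤s)) (subst (λ n → 2 ^ suc s ∣ φ n) (sym N≡2ˢq) (2^[1+s]∣φ[2^s*q] s odd-q 3φ<2ˢq))
  where
  k≤s : k ≤ s
  k≤s = 2^k∣2^s*odd⇒k≤s k s odd-q (subst (2 ^ k ∣_) N≡2ˢq 2ᵏ∣N)
  3φ<2ˢq : 3 * φ (2 ^ s * q) < 2 ^ s * q
  3φ<2ˢq = subst (λ n → 3 * φ n < n) N≡2ˢq 3φ<N

φ≢2^k*odd : ∀ {N k v} → 2 ^ k ∣ N → Odd v → 3 * φ N < N → φ N ≢ 2 ^ k * v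
φ≢2^k*odd {k = k} 2ᵏ∣N odd-v 3φ<N φN≡2ᵏv =
  n≮n k (2^k∣2^s*odd⇒k≤s (suc k) k odd-v (subst (2 ^ suc k ∣_) φN≡2ᵏv (2^[1+k]∣φ k 2ᵏ∣N 3φ<N)))

-- The Lucas sequence U
U : ℕ → ℕ → ℕ → ℕ
U x y zero    = 0
U x y (suc k) = y ^ k + x * U x y k

U-1 : ∀ x y → U x y 1 ≡ 1
U-1 x y = cong suc (*-zeroʳ x)

U-telescope : ∀ y d k → (y + d) ^ k ≡ y ^ k + d * U (y + d) y k
U-telescope y d zero    = cong suc (sym (*-zeroʳ d))
U-telescope y d (suc k) = begin-equality
  (y + d) * (y + d) ^ k                       ≡⟨ cong ((y + d) *_) (U-telescope y d k) ⟩
  (y + d) * (y ^ k + d * U (y + d) y k)       ≡⟨ regroup y d (y ^ k) (U (y + d) y k) ⟩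
  y * y ^ k + d * (y ^ k + (y + d) * U (y + d) y k) ∎
  where
  regroup : ∀ y d Y u → (y + d) * (Y + d * u) ≡ y * Y + d * (Y + (y + d) * u)
  regroup = solve-∀

U-div : ∀ {x y} k → y < x → (x ^ k ∸ y ^ k) / (x ∸ y) ≡ U x y k
U-div {x} {y} k y<x with o , refl ← m≤n⇒∃[o]m+o≡n y<x =
  subst (λ x → (x ^ k ∸ y ^ k) / (x ∸ y) ≡ U x y k) (+-suc y o) (begin-equality
    ((y + suc o) ^ k ∸ y ^ k) / (y + suc o ∸ y)
      ≡⟨ cong₂ _/_ (trans (cong (_∸ y ^ k) (U-telescope y (suc o) k)) (m+n∸m≡n (y ^ k) _)) (m+n∸m≡n y (suc o)) ⟩
    (suc o * U (y + suc o) y k) div suc o       ≡⟨ cong (_div suc o) (*-comm (suc o) (U (y + suc o) y k)) ⟩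
    (U (y + suc o) y k * suc o) div suc o       ≡⟨ m*n/n≡m (U (y + suc o) y k) (suc o) ⟩
    U (y + suc o) y k                           ∎)

U-≤-suc : ∀ {x} y k → 0 < x → U x y k ≤ U x y (suc k)
U-≤-suc {x} y k 0<x = begin
  U x y k          ≤⟨ m≤n*m (U x y k) x {{>-nonZero 0<x}} ⟩
  x * U x y k      ≤⟨ m≤n+m (x * U x y k) (y ^ k) ⟩
  U x y (suc k)    ∎

U-mono : ∀ {x} y {k l} → 0 < x → k ≤ l → U x y k ≤ U x y l
U-mono {x} y 0<x k≤l = go (≤⇒≤′ k≤l)
  where
  go : ∀ {k l} → k ≤′ l → U x y k ≤ U x y l
  go ≤′-refl            = ≤-refl
  go (≤′-step {l} k≤′l) = ≤-trans (go k≤′l) (U-≤-suc y l 0<x)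

x*U<U-suc : ∀ x {y} k → 0 < y → x * U x y k < U x y (suc k)
x*U<U-suc x {y} k 0<y = +-monoˡ-≤ (x * U x y k) (m^n>0 y {{>-nonZero 0<y}} k)

x<U : ∀ {x y m} → 0 < y → y < x → 2 ≤ m → x < U x y m
x<U {x} {y} {m} 0<y y<x 2≤m = <-≤-trans x<U₂ (U-mono y (≤-<-trans z≤n y<x) 2≤m)
  where
  x<U₂ : x < U x y 2
  x<U₂ = subst (_< U x y 2) (trans (cong (x *_) (U-1 x y)) (*-identityʳ x)) (x*U<U-suc x 1 0<y)

U-odd-x-even : ∀ {x y} k → 2 ∣ x → Odd y → Odd (U x y (suc k))
U-odd-x-even {x} {y} k 2∣x odd-y = odd+even (odd-^ k odd-y) (∣m⇒∣m*n (U x y k) 2∣x)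

U-odd-y-even : ∀ {x y} k → Odd x → 2 ∣ y → Odd (U x y (suc k))
U-odd-y-even {x} {y} zero    odd-x 2∣y = subst Odd (sym (U-1 x y)) odd-1
U-odd-y-even {x} {y} (suc k) odd-x 2∣y = even+odd (∣m⇒∣m*n (y ^ k) 2∣y) (odd-* odd-x (U-odd-y-even k odd-x 2∣y))

U-parity-odd : ∀ {x y} k → Odd x → Odd y → (2 ∣ k × 2 ∣ U x y k) ⊎ (Odd k × Odd (U x y k))
U-parity-odd zero odd-x odd-y = inj₁ (2 ∣0 , 2 ∣0)
U-parity-odd {x} {y} (suc k) odd-x odd-y with U-parity-odd k odd-x odd-y
... | inj₁ (2∣k , 2∣U) = inj₂ (subst Odd (+-comm k 1) (even+odd 2∣k odd-1) , odd+even (odd-^ k odd-y) (∣n⇒∣m*n x 2∣U))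
... | inj₂ (odd-k , odd-U) = inj₁ (subst (2 ∣_) (+-comm k 1) (odd+odd odd-k odd-1) , odd+odd (odd-^ k odd-y) (odd-* odd-x odd-U))

^-distribʳ-* : ∀ a b n → (a * b) ^ n ≡ a ^ n * b ^ n
^-distribʳ-* a b zero    = refl
^-distribʳ-* a b (suc n) = trans (cong (a * b *_) (^-distribʳ-* a b n)) (interchange a b (a ^ n) (b ^ n))

U-scale : ∀ x y c k → U (x * c) (y * c) (suc k) ≡ c ^ k * U x y (suc k)
U-scale x y c zero    = trans (U-1 (x * c) (y * c)) (sym (trans (*-identityˡ _) (U-1 x y)))
U-scale x y c (suc k) = begin-equality
  (y * c) ^ suc k + x * c * U (x * c) (y * c) (suc k) ≡⟨ cong₂ _+_ (^-distribʳ-* y c (suc k)) (cong (x * c *_) (U-scale x y c k)) ⟩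
  y ^ suc k * c ^ suc k + x * c * (c ^ k * U x y (suc k)) ≡⟨ regroup x c (c ^ k) (y ^ suc k) (U x y (suc k)) ⟩
  c * c ^ k * (y ^ suc k + x * U x y (suc k))           ∎
  where
  regroup : ∀ x c C Y u → Y * (c * C) + x * c * (C * u) ≡ c * C * (Y + x * u)
  regroup = solve-∀

U-2-adic : ∀ x {y n m} → 0 < x → Odd n → n ≤ m → ∃₂ λ a u → U x y n ≡ 2 ^ a * u × Odd u × 2 ^ a ∣ U x y m
-- Halve x and y while both are even; once one of them is odd, U x y n is odd (n being odd).
U-2-adic = <-rec _ step
  where
  Goal : ℕ → ℕ → ℕ → ℕ → Set
  Goal x y n m = ∃₂ λ a u → U x y n ≡ 2 ^ a * u × Odd u × 2 ^ a ∣ U x y m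
  odd-case : ∀ {x y n m} → Odd (U x y n) → Goal x y n m
  odd-case {x} {y} {n} {m} odd-U = 0 , U x y n , sym (*-identityˡ (U x y n)) , odd-U , 1∣ U x y m
  step : ∀ x → (∀ {x′} → x′ < x → ∀ {y n m} → 0 < x′ → Odd n → n ≤ m → Goal x′ y n m) →
         ∀ {y n m} → 0 < x → Odd n → n ≤ m → Goal x y n m
  step x rec {y} {zero}              0<x odd-n _ = contradiction (2 ∣0) odd-n
  step x rec {y} {suc n} {suc m} 0<x odd-n (s≤s n≤m) with 2 ∣? x | 2 ∣? y
  ... | yes 2∣x | no odd-y = odd-case {x} {y} {suc n} {suc m} (U-odd-x-even n 2∣x odd-y)
  ... | no odd-x | yes 2∣y = odd-case {x} {y} {suc n} {suc m} (U-odd-y-even n odd-x 2∣y)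
  ... | no odd-x | no odd-y with U-parity-odd (suc n) odd-x odd-y
  ...   | inj₁ (2∣n , _)   = contradiction 2∣n odd-n
  ...   | inj₂ (_ , odd-U) = odd-case {x} {y} {suc n} {suc m} odd-U
  step x rec {y} {suc n} {suc m} 0<x odd-n (s≤s n≤m) | yes (divides x′ refl) | yes (divides y′ refl) =
    halve (rec x′<x 0<x′ odd-n (s≤s n≤m))
    where
    0<x′ : 0 < x′
    0<x′ = *-cancelʳ-< 2 0 x′ 0<x
    x′<x : x′ < x′ * 2
    x′<x = m<m*n x′ 2 {{>-nonZero 0<x′}} ≤-refl
    halve : Goal x′ y′ (suc n) (suc m) → Goal (x′ * 2) (y′ * 2) (suc n) (suc m)
    halve (a , u , U′≡2ᵃu , odd-u , 2ᵃ∣U′) = n + a , u , U≡2ⁿ⁺ᵃu , odd-u , 2ⁿ⁺ᵃ∣U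
      where
      U≡2ⁿ⁺ᵃu : U (x′ * 2) (y′ * 2) (suc n) ≡ 2 ^ (n + a) * u
      U≡2ⁿ⁺ᵃu = begin-equality
        U (x′ * 2) (y′ * 2) (suc n) ≡⟨ U-scale x′ y′ 2 n ⟩
        2 ^ n * U x′ y′ (suc n)     ≡⟨ cong (2 ^ n *_) U′≡2ᵃu ⟩
        2 ^ n * (2 ^ a * u)         ≡⟨ *-assoc (2 ^ n) (2 ^ a) u ⟨
        2 ^ n * 2 ^ a * u           ≡⟨ cong (_* u) (^-distribˡ-+-* 2 n a) ⟨
        2 ^ (n + a) * u             ∎
      2ⁿ⁺ᵃ∣U : 2 ^ (n + a) ∣ U (x′ * 2) (y′ * 2) (suc m)
      2ⁿ⁺ᵃ∣U = subst₂ _∣_ (sym (^-distribˡ-+-* 2 n a)) (sym (U-scale x′ y′ 2 m))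
                 (*-pres-∣ (^-monoʳ-∣ 2 n≤m) 2ᵃ∣U′)

φ[U₂₁]≢U₂₁ : ∀ {m n} → 2 ≤ m → Odd n → φ (U 2 1 m) ≢ U 2 1 n
φ[U₂₁]≢U₂₁ {suc m} {zero}  _   odd-n _  = contradiction (2 ∣0) odd-n
φ[U₂₁]≢U₂₁ {suc m} {suc n} 2≤m _     eq =
  U-odd-x-even n ∣-refl odd-1 (subst (2 ∣_) eq (2∣φ-odd (U 2 1 (suc m)) 1<U (U-odd-x-even m ∣-refl odd-1)))
  where
  1<U : 1 < U 2 1 (suc m)
  1<U = <-trans (s≤s (s≤s z≤n)) (x<U (s≤s z≤n) (s≤s (s≤s z≤n)) 2≤m)

φ[zUₘ]≡zUₙ⇒n<m : ∀ {x y z m n} → 0 < y → y < x → 0 < z → 2 ≤ m →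
                  φ (z * U x y m) ≡ z * U x y n → n < m
φ[zUₘ]≡zUₙ⇒n<m {x} {y} {z} {m} {n} 0<y y<x 0<z 2≤m φN≡M with n <? m
... | yes n<m = n<m
... | no  n≮m = contradiction (φ<n N {{n>1⇒nonTrivial 1<N}}) (≤⇒≯ (begin
  N     ≤⟨ *-monoʳ-≤ z (U-mono y (≤-<-trans z≤n y<x) (≮⇒≥ n≮m)) ⟩
  M     ≡⟨ φN≡M ⟨
  φ N   ∎))
  where
  N = z * U x y m
  M = z * U x y n
  1<N : 1 < N
  1<N = <-≤-trans (<-trans (≤-<-trans 0<y y<x) (x<U 0<y y<x 2≤m)) (m≤n*m (U x y m) z {{>-nonZero 0<z}})

x*φ[zUₘ]<zUₘ : ∀ {x y z m n} → 0 < y → y < x → 0 < z → n < m →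
               φ (z * U x y m) ≡ z * U x y n → x * φ (z * U x y m) < z * U x y m
x*φ[zUₘ]<zUₘ {x} {y} {z} {m} {n} 0<y y<x 0<z n<m φN≡M = begin-strict
  x * φ (z * U x y m) ≡⟨ cong (x *_) φN≡M ⟩
  x * (z * U x y n)   ≡⟨ x∙yz≈y∙xz x z (U x y n) ⟩
  z * (x * U x y n)   <⟨ *-monoʳ-< z {{>-nonZero 0<z}} (x*U<U-suc x n 0<y) ⟩
  z * U x y (suc n)   ≤⟨ *-monoʳ-≤ z (U-mono y (≤-<-trans z≤n y<x) n<m) ⟩
  z * U x y m         ∎

φ[zUₘ]≢zUₙ : ∀ {x y z m n} → 0 < y → y < x → 0 < z → z ≤ x ∸ y → 2 ≤ m → Odd n →
             φ (z * U x y m) ≢ z * U x y n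
φ[zUₘ]≢zUₙ {x} {y} {z} {m} {n} 0<y y<x 0<z z≤x∸y 2≤m odd-n φN≡M with 3 ≤? x
... | no x≱3
  with refl ← ≤-antisym (≤-pred (≰⇒> x≱3)) (≤-trans (s≤s 0<y) y<x)
  with refl ← ≤-antisym (≤-pred y<x) 0<y
  with refl ← ≤-antisym z≤x∸y 0<z
  = φ[U₂₁]≢U₂₁ 2≤m odd-n (subst₂ (λ N M → φ N ≡ M) (*-identityˡ (U 2 1 m)) (*-identityˡ (U 2 1 n)) φN≡M)
... | yes 3≤x = conclude (factor-out 2 z 0<z) (U-2-adic x (≤-<-trans z≤n y<x) odd-n (<⇒≤ n<m))
  where
  N = z * U x y m
  M = z * U x y n
  n<m : n < m
  n<m = φ[zUₘ]≡zUₙ⇒n<m 0<y y<x 0<z 2≤m φN≡M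
  3φ<N : 3 * φ N < N
  3φ<N = ≤-<-trans (*-monoˡ-≤ (φ N) 3≤x) (x*φ[zUₘ]<zUₘ 0<y y<x 0<z n<m φN≡M)
  conclude : (∃₂ λ t r → z ≡ 2 ^ t * r × Odd r) →
             (∃₂ λ a u → U x y n ≡ 2 ^ a * u × Odd u × 2 ^ a ∣ U x y m) → ⊥
  conclude (t , r , z≡2ᵗr , odd-r) (a , u , Uₙ≡2ᵃu , odd-u , 2ᵃ∣Uₘ) =
    φ≢2^k*odd {k = t + a} 2ᵗ⁺ᵃ∣N (odd-* odd-r odd-u) 3φ<N (trans φN≡M M≡2ᵗ⁺ᵃru)
    where
    2ᵗ⁺ᵃ∣N : 2 ^ (t + a) ∣ N
    2ᵗ⁺ᵃ∣N = subst₂ _∣_ (sym (^-distribˡ-+-* 2 t a)) (cong (_* U x y m) (sym z≡2ᵗr))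
               (*-pres-∣ (∣m⇒∣m*n r (∣-refl {2 ^ t})) 2ᵃ∣Uₘ)
    M≡2ᵗ⁺ᵃru : M ≡ 2 ^ (t + a) * (r * u)
    M≡2ᵗ⁺ᵃru = begin-equality
      z * U x y n               ≡⟨ cong₂ _*_ z≡2ᵗr Uₙ≡2ᵃu ⟩
      2 ^ t * r * (2 ^ a * u)   ≡⟨ interchange (2 ^ t) r (2 ^ a) u ⟩
      2 ^ t * 2 ^ a * (r * u)   ≡⟨ cong (_* (r * u)) (^-distribˡ-+-* 2 t a) ⟨
      2 ^ (t + a) * (r * u)     ∎

lemma1 : (x y z m n : ℕ) → 0 < y → y < x → 0 < z → 0 < m → 0 < n →
         φ (z * ((x ^ m ∸ y ^ m) / (x ∸ y))) ≡ z * ((x ^ n ∸ y ^ n) / (x ∸ y)) →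
         ¬ (z ≡ 1 × m ≡ 1 × n ≡ 1) →
         z ≤ x ∸ y → gcd m n ≡ 1 → m % 2 ≡ 1
lemma1 x y z m n 0<y y<x 0<z 0<m _ φ≡ _ z≤x∸y gcd[m,n]≡1 = odd⇒%2≡1 odd-m
  where
  φ[zUₘ]≡zUₙ : φ (z * U x y m) ≡ z * U x y n
  φ[zUₘ]≡zUₙ = subst₂ (λ a b → φ (z * a) ≡ z * b) (U-div m y<x) (U-div n y<x) φ≡
  odd-m : Odd m
  odd-m 2∣m = φ[zUₘ]≢zUₙ 0<y y<x 0<z z≤x∸y (∣⇒≤ {{>-nonZero 0<m}} 2∣m) odd-n φ[zUₘ]≡zUₙ
    where
    odd-n : Odd n
    odd-n 2∣n = odd-1 (subst (2 ∣_) gcd[m,n]≡1 (gcd-greatest 2∣m 2∣n))
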